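{- Let $k\ge1$, $n=k^2$, and let $a,b\le k$ be positive integers. For every set $A\subseteq\{1,\dots,n\}$ with $|A|=k\cdot\max\{a,b\}$, there exists an $(ak,b,n)$-Sudoku rectangle all of whose filled entries belong to $A$.
   Context: For $n=k^2$, an $n\times n$ matrix is divided into $k^2$ blocks: for $i,j\in[k]$ the $(i,j)$th block consists of the cells $((i-1)k+x,(j-1)k+y)$, $x,y\in[k]$. A partial Sudoku square of order $n$ is an $n\times n$ matrix with entries in $\{1,\dots,n\}\cup\{*\}$ ($*$ meaning an empty cell) such that each number of $\{1,\dots,n\}$ appears at most once in each row, at most once in each column, and at most once in each block. For $p,q\le n$, a $(p,q,n)$-Sudoku rectangle is a partial Sudoku square of order $n$ in which all cells lying in the intersection of the first $p$ rows and the first $q$ columns are filled and all remaining cells are empty. -}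

module Defs where

open import Data.Nat using (ℕ; suc; _*_; _<_; NonZero)
open import Data.Nat.DivMod using (_/_)
open import Data.Fin using (Fin; toℕ)
open import Data.Fin.Subset using (Subset; _∈_)
open import Data.Maybe using (Maybe; just; nothing)
open import Data.Product using (_×_)
open import Relation.Binary.PropositionalEquality using (_≡_; _≢_)
open import Relation.Nullary using (¬_)

-- A partial array of order n: cell (r , c) holds  just s  (symbol s, where
-- Fin n = {0..n-1} encodes {1..n}) or  nothing  (the empty cell *).
-- Rows/columns are indexed 0..n-1 (0-based version of 1..n).
Array : ℕ → Set
Array n = Fin n → Fin n → Maybe (Fin n)

blk : (k : ℕ) → .{{_ : NonZero k}} → Fin (k * k) → ℕ
blk k i = toℕ i / k

IsPartialSudoku : (k : ℕ) → .{{_ : NonZero k}} → Array (k * k) → Set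
IsPartialSudoku k M =
  (∀ r c c' s → M r c ≡ just s → M r c' ≡ just s → c ≡ c') ×
  (∀ r r' c s → M r c ≡ just s → M r' c ≡ just s → r ≡ r') ×
  (∀ r c r' c' s → blk k r ≡ blk k r' → blk k c ≡ blk k c' →
     M r c ≡ just s → M r' c' ≡ just s → (r ≡ r' × c ≡ c'))

IsSudokuRectangle : (k : ℕ) → .{{_ : NonZero k}} → ℕ → ℕ → Array (k * k) → Set
IsSudokuRectangle k p q M =
  IsPartialSudoku k M ×
  (∀ r c → toℕ r < p → toℕ c < q → M r c ≢ nothing) ×
  (∀ r c → ¬ (toℕ r < p × toℕ c < q) → M r c ≡ nothing)

EntriesIn : ∀ {n} → Subset n → Array n → Set
EntriesIn A M = ∀ r c s → M r c ≡ just s → s ∈ A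

-- Write n = k², m = max(a,b), and index A injectively by pairs (x , y) ∈ [k] × [m].
-- The cell (r , c) of the rectangle receives the element of index (x , (d + c) mod m)
-- where r = d·k + x: the row block number d of a row cyclically shifts the second
-- coordinate, and x is the position of the row inside its block. Within a row the
-- symbols differ because the shift is injective in c; rows of the same block differ in
-- x; two rows sharing a symbol in a column have the same x and, since d < a ≤ m, the
-- same d.
module Submission where

open import Defs
open import Data.Nat using (ℕ; _+_; _*_; _∸_; _⊔_; _≤_; _<_; _<?_; NonZero; >-nonZero)
open import Data.Nat.Properties
  using (≤-trans; m≤m⊔n; m≤n⊔m; m+[n∸m]≡n; +-comm; +-assoc)
open import Data.Nat.DivMod
  using (_/_; _%_; _mod_; m≡m%n+[m/n]*n; %-distribˡ-+; m%n%n≡m%n; [m+kn]%n≡m%n;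
         m<n⇒m%n≡m; m%n≤n; m<n*o⇒m/o<n)
open import Data.Nat.Tactic.RingSolver using (solve-∀)
open import Data.Fin using (Fin; toℕ; zero; suc; combine)
open import Data.Fin.Properties using (toℕ-injective; toℕ-fromℕ<; suc-injective; combine-injective)
open import Data.Fin.Subset using (Subset; ∣_∣; inside; outside; _∈_)
open import Data.Vec using ([]; _∷_; here; there)
open import Data.Maybe using (just; nothing)
open import Data.Product using (Σ; _×_; _,_; proj₁; proj₂)
open import Function using (_∘_; Injective)
open import Relation.Nullary using (yes; no; ¬_; _×-dec_; contradiction)
open import Relation.Binary.PropositionalEquality
  using (_≡_; _≢_; refl; sym; trans; cong; subst; module ≡-Reasoning)

record Enumeration {n : ℕ} (A : Subset n) (t : ℕ) : Set where
  field
    elem           : Fin t → Fin n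
    elem-injective : Injective _≡_ _≡_ elem
    elem-∈         : ∀ j → elem j ∈ A

enumerate : ∀ {n} (A : Subset n) → Enumeration A ∣ A ∣
enumerate [] = record { elem = λ () ; elem-injective = λ { {()} } ; elem-∈ = λ () }
enumerate (outside ∷ A) = record
  { elem           = suc ∘ elem
  ; elem-injective = elem-injective ∘ suc-injective
  ; elem-∈         = there ∘ elem-∈
  }
  where open Enumeration (enumerate A)
enumerate (inside ∷ A) = record { elem = elem′ ; elem-injective = injective ; elem-∈ = ∈A }
  where
  open Enumeration (enumerate A)
  elem′ : Fin ∣ inside ∷ A ∣ → Fin _
  elem′ zero    = zero
  elem′ (suc j) = suc (elem j)
  injective : Injective _≡_ _≡_ elem′
  injective {zero}  {zero}  _ = refl
  injective {suc i} {suc j} e = cong suc (elem-injective (suc-injective e))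
  ∈A : ∀ j → elem′ j ∈ (inside ∷ A)
  ∈A zero    = here
  ∈A (suc j) = there (elem-∈ j)

module _ {m : ℕ} .{{_ : NonZero m}} where

  %-/-injective : ∀ {r r′} → r % m ≡ r′ % m → r / m ≡ r′ / m → r ≡ r′
  %-/-injective {r} {r′} eq₁ eq₂ = begin
    r                    ≡⟨ m≡m%n+[m/n]*n r m ⟩
    r % m + r / m * m    ≡⟨ cong (_+ r / m * m) eq₁ ⟩
    r′ % m + r / m * m   ≡⟨ cong (λ q → r′ % m + q * m) eq₂ ⟩
    r′ % m + r′ / m * m  ≡⟨ m≡m%n+[m/n]*n r′ m ⟨
    r′                   ∎
    where open ≡-Reasoning

  [m%n+o]%n≡[m+o]%n : ∀ x y → (x % m + y) % m ≡ (x + y) % m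
  [m%n+o]%n≡[m+o]%n x y = begin
    (x % m + y) % m          ≡⟨ %-distribˡ-+ (x % m) y m ⟩
    (x % m % m + y % m) % m  ≡⟨ cong (λ z → (z + y % m) % m) (m%n%n≡m%n x m) ⟩
    (x % m + y % m) % m      ≡⟨ %-distribˡ-+ x y m ⟨
    (x + y) % m              ∎
    where open ≡-Reasoning

  unshift : ∀ i c → c < m → ((i + c) % m + (m ∸ i % m)) % m ≡ c
  unshift i c c<m = begin
    ((i + c) % m + (m ∸ i % m)) % m       ≡⟨ [m%n+o]%n≡[m+o]%n (i + c) (m ∸ i % m) ⟩
    (i + c + (m ∸ i % m)) % m
      ≡⟨ cong (λ j → (j + c + (m ∸ i % m)) % m) (m≡m%n+[m/n]*n i m) ⟩
    (i % m + i / m * m + c + (m ∸ i % m)) % m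
      ≡⟨ cong (_% m) (rearrange (i % m) (i / m * m) c (m ∸ i % m)) ⟩
    (c + (i % m + (m ∸ i % m)) + i / m * m) % m
      ≡⟨ cong (λ j → (c + j + i / m * m) % m) (m+[n∸m]≡n (m%n≤n i m)) ⟩
    (c + m + i / m * m) % m               ≡⟨ cong (_% m) (+-assoc c m (i / m * m)) ⟩
    (c + (1 + i / m) * m) % m             ≡⟨ [m+kn]%n≡m%n c (1 + i / m) m ⟩
    c % m                                 ≡⟨ m<n⇒m%n≡m c<m ⟩
    c                                     ∎
    where
    open ≡-Reasoning
    rearrange : ∀ x y z w → x + y + z + w ≡ z + (x + w) + y
    rearrange = solve-∀

  +-%-cancelˡ : ∀ i {c c′} → c < m → c′ < m → (i + c) % m ≡ (i + c′) % m → c ≡ c′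
  +-%-cancelˡ i {c} {c′} c<m c′<m eq = begin
    c                                 ≡⟨ unshift i c c<m ⟨
    ((i + c) % m + (m ∸ i % m)) % m   ≡⟨ cong (λ j → (j + (m ∸ i % m)) % m) eq ⟩
    ((i + c′) % m + (m ∸ i % m)) % m  ≡⟨ unshift i c′ c′<m ⟩
    c′                                ∎
    where open ≡-Reasoning

  +-%-cancelʳ : ∀ i {c c′} → c < m → c′ < m → (c + i) % m ≡ (c′ + i) % m → c ≡ c′
  +-%-cancelʳ i {c} {c′} c<m c′<m eq = +-%-cancelˡ i c<m c′<m (begin
    (i + c) % m   ≡⟨ cong (_% m) (+-comm i c) ⟩
    (c + i) % m   ≡⟨ eq ⟩
    (c′ + i) % m  ≡⟨ cong (_% m) (+-comm c′ i) ⟩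
    (i + c′) % m  ∎)
    where open ≡-Reasoning

module _ {n : ℕ} where

  InRectangle : ℕ → ℕ → Fin n → Fin n → Set
  InRectangle p q r c = toℕ r < p × toℕ c < q

  rectangle : (p q : ℕ) → (Fin n → Fin n → Fin n) → Array n
  rectangle p q f r c with (toℕ r <? p) ×-dec (toℕ c <? q)
  ... | yes _ = just (f r c)
  ... | no _  = nothing

  module _ {p q : ℕ} {f : Fin n → Fin n → Fin n} where

    rectangle-just : ∀ {r c s} → rectangle p q f r c ≡ just s → InRectangle p q r c × f r c ≡ s
    rectangle-just {r} {c} eq with (toℕ r <? p) ×-dec (toℕ c <? q)
    rectangle-just refl | yes rc = rc , refl

    rectangle-filled : ∀ {r c} → InRectangle p q r c → rectangle p q f r c ≢ nothing
    rectangle-filled {r} {c} rc with (toℕ r <? p) ×-dec (toℕ c <? q)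
    ... | yes _  = λ ()
    ... | no ¬rc = λ _ → ¬rc rc

    rectangle-empty : ∀ {r c} → ¬ InRectangle p q r c → rectangle p q f r c ≡ nothing
    rectangle-empty {r} {c} ¬rc with (toℕ r <? p) ×-dec (toℕ c <? q)
    ... | yes rc = contradiction rc ¬rc
    ... | no _   = refl

    rectangle-entriesIn : {A : Subset n} → (∀ r c → f r c ∈ A) → EntriesIn A (rectangle p q f)
    rectangle-entriesIn {A} f∈A r c s eq = subst (_∈ A) (proj₂ (rectangle-just eq)) (f∈A r c)

record SudokuPattern (k : ℕ) .{{_ : NonZero k}} (p q : ℕ)
                     (f : Fin (k * k) → Fin (k * k) → Fin (k * k)) : Set where
  field
    row-injective    : ∀ {r c c′} → InRectangle p q r c → InRectangle p q r c′ →
                       f r c ≡ f r c′ → c ≡ c′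
    column-injective : ∀ {r r′ c} → InRectangle p q r c → InRectangle p q r′ c →
                       f r c ≡ f r′ c → r ≡ r′
    block-injective  : ∀ {r c r′ c′} → InRectangle p q r c → InRectangle p q r′ c′ →
                       blk k r ≡ blk k r′ → f r c ≡ f r′ c′ → r ≡ r′

module _ (k : ℕ) .{{_ : NonZero k}} {p q : ℕ} {f : Fin (k * k) → Fin (k * k) → Fin (k * k)} where

  rectangle-isSudokuRectangle : SudokuPattern k p q f → IsSudokuRectangle k p q (rectangle p q f)
  rectangle-isSudokuRectangle isPattern =
    (rows , columns , blocks) ,
    (λ _ _ r<p c<q → rectangle-filled (r<p , c<q)) ,
    (λ _ _ → rectangle-empty)
    where
    open SudokuPattern isPattern
    M = rectangle p q f
    sameSymbol : ∀ {r c r′ c′ s} → M r c ≡ just s → M r′ c′ ≡ just s →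
                 InRectangle p q r c × InRectangle p q r′ c′ × f r c ≡ f r′ c′
    sameSymbol e e′ with rectangle-just e | rectangle-just e′
    ... | rc , refl | rc′ , fs = rc , rc′ , sym fs
    rows : ∀ r c c′ s → M r c ≡ just s → M r c′ ≡ just s → c ≡ c′
    rows _ _ _ _ e e′ with sameSymbol e e′
    ... | rc , rc′ , same = row-injective rc rc′ same
    columns : ∀ r r′ c s → M r c ≡ just s → M r′ c ≡ just s → r ≡ r′
    columns _ _ _ _ e e′ with sameSymbol e e′
    ... | rc , rc′ , same = column-injective rc rc′ same
    blocks : ∀ r c r′ c′ s → blk k r ≡ blk k r′ → blk k c ≡ blk k c′ →
             M r c ≡ just s → M r′ c′ ≡ just s → r ≡ r′ × c ≡ c′
    blocks _ _ _ _ _ sameBlock _ e e′ with sameSymbol e e′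
    ... | rc , rc′ , same with refl ← block-injective rc rc′ sameBlock same =
      refl , row-injective rc rc′ same

module _ (k : ℕ) .{{_ : NonZero k}} {m : ℕ} .{{_ : NonZero m}} where

  cyclicSymbol : Fin (k * k) → Fin (k * k) → Fin (k * m)
  cyclicSymbol r c = combine (toℕ r mod k) ((toℕ r / k + toℕ c) mod m)

  cyclicSymbol-components : ∀ {r c r′ c′} → cyclicSymbol r c ≡ cyclicSymbol r′ c′ →
    toℕ r % k ≡ toℕ r′ % k × (toℕ r / k + toℕ c) % m ≡ (toℕ r′ / k + toℕ c′) % m
  cyclicSymbol-components {r} {c} {r′} {c′} eq
    with eq₁ , eq₂ ← combine-injective (toℕ r mod k) _ (toℕ r′ mod k) _ eq
    = mod≡⇒%≡ eq₁ , mod≡⇒%≡ eq₂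
    where
    mod≡⇒%≡ : ∀ {d x y} .{{_ : NonZero d}} → x mod d ≡ y mod d → x % d ≡ y % d
    mod≡⇒%≡ eq = trans (sym (toℕ-fromℕ< _)) (trans (cong toℕ eq) (toℕ-fromℕ< _))

  cyclicSymbol-sudokuPattern : ∀ {a b} → a ≤ m → b ≤ m → {g : Fin (k * m) → Fin (k * k)} →
    Injective _≡_ _≡_ g → SudokuPattern k (a * k) b (λ r c → g (cyclicSymbol r c))
  cyclicSymbol-sudokuPattern {a} {b} a≤m b≤m {g} g-injective = record
    { row-injective    = λ { {r} (_ , c<b) (_ , c′<b) eq →
        toℕ-injective (+-%-cancelˡ (toℕ r / k) (column< c<b) (column< c′<b)
                                   (proj₂ (sameSymbol eq))) }
    ; column-injective = λ { {r} {r′} {c} (r<ak , _) (r′<ak , _) eq →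
        let eq₁ , eq₂ = sameSymbol eq in
        toℕ-injective (%-/-injective eq₁ (+-%-cancelʳ (toℕ c) (block< r<ak) (block< r′<ak) eq₂)) }
    ; block-injective  = λ _ _ sameBlock eq →
        toℕ-injective (%-/-injective (proj₁ (sameSymbol eq)) sameBlock)
    }
    where
    sameSymbol : ∀ {r c r′ c′} → g (cyclicSymbol r c) ≡ g (cyclicSymbol r′ c′) →
      toℕ r % k ≡ toℕ r′ % k × (toℕ r / k + toℕ c) % m ≡ (toℕ r′ / k + toℕ c′) % m
    sameSymbol = cyclicSymbol-components ∘ g-injective
    column< : ∀ {c} → c < b → c < m
    column< c<b = ≤-trans c<b b≤m
    block< : ∀ {r} → r < a * k → r / k < m
    block< r<ak = ≤-trans (m<n*o⇒m/o<n r<ak) a≤m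

lemma2 : (k : ℕ) → .{{_ : NonZero k}} → (a b : ℕ) → 1 ≤ a → a ≤ k → 1 ≤ b → b ≤ k →
    (A : Subset (k * k)) → ∣ A ∣ ≡ k * (a ⊔ b) →
    Σ (Array (k * k)) λ M →
      IsSudokuRectangle k (a * k) b M × EntriesIn A M
lemma2 k a b 1≤a _ _ _ A ∣A∣≡k[a⊔b] =
  rectangle (a * k) b symbol ,
  rectangle-isSudokuRectangle k
    (cyclicSymbol-sudokuPattern k (m≤m⊔n a b) (m≤n⊔m a b) elem-injective) ,
  rectangle-entriesIn (λ r c → elem-∈ (cyclicSymbol k r c))
  where
  instance
    a⊔b-nonZero : NonZero (a ⊔ b)
    a⊔b-nonZero = >-nonZero (≤-trans 1≤a (m≤m⊔n a b))
  open Enumeration (subst (Enumeration A) ∣A∣≡k[a⊔b] (enumerate A))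
  symbol : Fin (k * k) → Fin (k * k) → Fin (k * k)
  symbol r c = elem (cyclicSymbol k r c)
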